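{- Let $U(0)$ and $d$ be positive integers, $U(n)=U(0)+nd$, and let $(S(n))_{n\geqslant0}$ be the left-concatenation of $(U(n))_{n\geqslant0}$ (so $S(0)=U(0)$). For an integer $n\geqslant0$ put $$l=\lceil \log_{10}(n d+S(0)+1)\rceil,\qquad t_l=\left\lfloor \frac{10^{l-1}-S(0)}{d}\right\rfloor,$$ and assume $t_l\geqslant0$ and that there are at least four indices $m\geqslant0$ such that $U(m)$ has exactly $l$ decimal digits. Let $p_l$ be the number of decimal digits of $S(t_l)$, let $s_0=S(t_l)$, $s_1=S(t_l+1)$, $s_2=S(t_l+2)$, and $$\alpha_l=\frac{s_2-2\cdot10^l s_1+10^{2l}s_0}{(10^l-1)^2},\qquad \mu_l=\frac{\big((10^l-1)\,U(t_l)-d\big)\,10^{p_l}}{(10^l-1)^2},\qquad \theta_l=\frac{d\cdot 10^{p_l}}{10^l-1}.$$ Then $$S(n)=\alpha_l+\mu_l\,10^{l(n-t_l)}+\theta_l\,(n-t_l)\,10^{l(n-t_l)} .$$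
   Context: The left-concatenation of a sequence of positive integers $(U(n))_{n\geqslant0}$ is the sequence $S(n)$ whose decimal representation is the concatenation of the decimal representations of $U(n),U(n-1),\ldots,U(0)$ in this order; equivalently $S(0)=U(0)$ and $S(n+1)=U(n+1)\cdot 10^{k}+S(n)$ where $k$ is the number of decimal digits of $S(n)$. Note $l$ is the number of decimal digits of $U(n)$. -}

module Defs where

open import Data.Nat using (ℕ; zero; suc; _+_; _*_; _∸_; _^_; _≤ᵇ_; _/_; NonZero)
open import Data.Bool using (if_then_else_)
open import Data.Integer using (ℤ; +_)
import Data.Rational as ℚ
open import Data.Rational using (ℚ)

-- Number of decimal digits of a natural number (ndigits 0 = 1 by convention;
-- only applied to positive numbers here). Fuel = n suffices since n/10 < n for n ≥ 10.
ndigitsAux : ℕ → ℕ → ℕ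
ndigitsAux zero    n = 1
ndigitsAux (suc f) n with n / 10
... | zero  = 1
... | suc q = suc (ndigitsAux f (suc q))

ndigits : ℕ → ℕ
ndigits n = ndigitsAux n n

-- ⌈log₁₀ x⌉ for x ≥ 1: the least k with x ≤ 10^k (search with fuel; 10^x ≥ x).
ceilLog10Aux : ℕ → ℕ → ℕ → ℕ
ceilLog10Aux x zero    k = k
ceilLog10Aux x (suc f) k = if x ≤ᵇ 10 ^ k then k else ceilLog10Aux x f (suc k)

ceilLog10 : ℕ → ℕ
ceilLog10 x = ceilLog10Aux x (suc x) 0

U : (U0 d : ℕ) → ℕ → ℕ
U U0 d n = U0 + n * d

S : (U0 d : ℕ) → ℕ → ℕ
S U0 d zero    = U U0 d zero
S U0 d (suc n) = U U0 d (suc n) * 10 ^ ndigits (S U0 d n) + S U0 d n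

-- Division of an integer by a natural number as a rational; the denominator 0
-- case is a dummy value (never used: all denominators below are ≥ 9).
_/ℕ_ : ℤ → ℕ → ℚ
i /ℕ zero  = ℚ.0ℚ
i /ℕ suc n = i ℚ./ suc n

ℕtoℚ : ℕ → ℚ
ℕtoℚ n = (+ n) /ℕ 1

-- Since n d + S(0) + 1 = U(n) + 1, l is the number of digits of U(n), and t is the last index
-- with U(t) ≤ 10^(l-1); so every term U(t+1), …, U(n) has exactly l digits. Writing L = 10^l and
-- P = 10^(p_l), left-concatenation of these terms gives S(t+j) = S(t) + P·F_j with
-- F_j = Σ_{i<j} U(t+1+i) L^i, and the arithmetico-geometric sum F_j has a closed form with
-- denominator (L-1)². The extra indices force U(t+2) < L, so s₁ and s₂ obey the same formula,
-- and α_l, μ_l, θ_l are the coefficients of the closed form once (L-1)² S(n) is expanded.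
module Submission where

open import Defs
open import Data.Nat using (ℕ; zero; suc; _+_; _*_; _∸_; _^_; _/_; _%_; _≤_; _<_; _≤ᵇ_; z≤n; s≤s;
  NonZero; >-nonZero; >-nonZero⁻¹; ≢-nonZero; ≢-nonZero⁻¹)
open import Data.Nat.Properties
open import Data.Nat.DivMod using (m≡m%n+[m/n]*n; m%n<n; m/n<m; m/n≡0⇒m<n)
import Data.Nat.Tactic.RingSolver as ℕ-Solver
open import Data.Integer using (ℤ; +_; ∣_∣) renaming (_-_ to _-ℤ_; _+_ to _+ℤ_; _*_ to _*ℤ_; _≤_ to _≤ℤ_)
import Data.Integer.Properties as ℤP
open import Data.Integer.DivMod using (a≡a%n+[a/n]*n; n%d<d) renaming (_%_ to _%ℤ_)
import Data.Integer.Tactic.RingSolver as ℤ-Solver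
open import Data.Rational using (ℚ; floor) renaming (_+_ to _+ℚ_; _*_ to _*ℚ_; _/_ to _/ℚ_)
import Data.Rational as ℚ
import Data.Rational.Properties as ℚP
open import Data.Rational.Solver using () renaming (module +-*-Solver to ℚ-Solver)
import Data.Rational.Unnormalised as ℚᵘ
import Data.Rational.Unnormalised.Properties as ℚᵘP
open import Data.Bool using (true; false; T)
open import Data.Empty using (⊥-elim)
open import Data.Product using (∃; _×_; _,_; proj₁; proj₂)
open import Relation.Binary.PropositionalEquality
  using (_≡_; refl; sym; trans; cong; cong₂; subst; subst₂; module ≡-Reasoning)

10^-cancel-< : ∀ {m n} → 10 ^ m < 10 ^ n → m < n
10^-cancel-< p = ≰⇒> λ n≤m → <⇒≱ p (^-monoʳ-≤ 10 n≤m)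

10^-window-unique : ∀ {x r s} → 10 ^ r ≤ x → x < 10 ^ suc r → 10 ^ s ≤ x → x < 10 ^ suc s → r ≡ s
10^-window-unique r≤ <r s≤ <s =
  ≤-antisym (≤-pred (10^-cancel-< (≤-<-trans r≤ <s))) (≤-pred (10^-cancel-< (≤-<-trans s≤ <r)))

ndigitsAux-spec : ∀ f x → 1 ≤ x → x ≤ f →
  ∃ λ r → ndigitsAux f x ≡ suc r × 10 ^ r ≤ x × x < 10 ^ suc r
ndigitsAux-spec zero    x 1≤x x≤0 = ⊥-elim (<⇒≱ 1≤x x≤0)
ndigitsAux-spec (suc f) x 1≤x x≤f with x / 10 in x/10≡
... | zero  = 0 , refl , 1≤x , m/n≡0⇒m<n x/10≡
... | suc q with ndigitsAux-spec f (suc q) (s≤s z≤n) q<f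
  where
  q<f : suc q ≤ f
  q<f = ≤-pred (≤-trans (subst (λ z → suc z ≤ x) x/10≡ (m/n<m x 10 {{>-nonZero 1≤x}} (s≤s (s≤s z≤n)))) x≤f)
...   | r , eq , lo , hi = suc r , cong suc eq , lo′ , hi′
  where
  x≡ : x ≡ x % 10 + suc q * 10
  x≡ = trans (m≡m%n+[m/n]*n x 10) (cong (λ z → x % 10 + z * 10) x/10≡)
  lo′ : 10 ^ suc r ≤ x
  lo′ = begin
    10 * 10 ^ r           ≤⟨ *-monoʳ-≤ 10 lo ⟩
    10 * suc q            ≡⟨ *-comm 10 (suc q) ⟩
    suc q * 10            ≤⟨ m≤n+m (suc q * 10) (x % 10) ⟩
    x % 10 + suc q * 10   ≡⟨ x≡ ⟨
    x                     ∎
    where open ≤-Reasoning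
  hi′ : x < 10 ^ suc (suc r)
  hi′ = begin-strict
    x                     ≡⟨ x≡ ⟩
    x % 10 + suc q * 10   <⟨ +-monoˡ-< (suc q * 10) (m%n<n x 10) ⟩
    10 + suc q * 10       ≡⟨ *-comm (suc (suc q)) 10 ⟩
    10 * suc (suc q)      ≤⟨ *-monoʳ-≤ 10 hi ⟩
    10 * 10 ^ suc r       ∎
    where open ≤-Reasoning

ndigits-spec : ∀ x → 1 ≤ x → ∃ λ r → ndigits x ≡ suc r × 10 ^ r ≤ x × x < 10 ^ suc r
ndigits-spec x 1≤x = ndigitsAux-spec x x 1≤x ≤-refl

ndigits-unique : ∀ {x r} → 10 ^ r ≤ x → x < 10 ^ suc r → ndigits x ≡ suc r
ndigits-unique {x} {r} lo hi with ndigits-spec x (≤-trans (m^n>0 10 r) lo)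
... | s , eq , lo′ , hi′ = trans eq (cong suc (10^-window-unique {x} lo′ hi′ lo hi))

ndigits-bounds : ∀ {x r} → 1 ≤ x → ndigits x ≡ suc r → 10 ^ r ≤ x × x < 10 ^ suc r
ndigits-bounds {x} 1≤x eq with ndigits-spec x 1≤x
... | s , eq′ , lo , hi with suc-injective (trans (sym eq′) eq)
... | refl = lo , hi

x<10^ndigits : ∀ x → x < 10 ^ ndigits x
x<10^ndigits zero    = s≤s z≤n
x<10^ndigits (suc x) with ndigits-spec (suc x) (s≤s z≤n)
... | r , eq , _ , hi = subst (λ z → suc x < 10 ^ z) (sym eq) hi

ndigits-concat : ∀ {a r} b → 10 ^ r ≤ a → a < 10 ^ suc r →
  ndigits (a * 10 ^ ndigits b + b) ≡ suc r + ndigits b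
ndigits-concat {a} {r} b lo hi = ndigits-unique lo′ hi′
  where
  q : ℕ
  q = ndigits b
  lo′ : 10 ^ (r + q) ≤ a * 10 ^ q + b
  lo′ = begin
    10 ^ (r + q)      ≡⟨ ^-distribˡ-+-* 10 r q ⟩
    10 ^ r * 10 ^ q   ≤⟨ *-monoˡ-≤ (10 ^ q) lo ⟩
    a * 10 ^ q        ≤⟨ m≤m+n (a * 10 ^ q) b ⟩
    a * 10 ^ q + b    ∎
    where open ≤-Reasoning
  hi′ : a * 10 ^ q + b < 10 ^ suc (r + q)
  hi′ = begin-strict
    a * 10 ^ q + b       <⟨ +-monoʳ-< (a * 10 ^ q) (x<10^ndigits b) ⟩
    a * 10 ^ q + 10 ^ q  ≡⟨ +-comm (a * 10 ^ q) (10 ^ q) ⟩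
    suc a * 10 ^ q       ≤⟨ *-monoˡ-≤ (10 ^ q) hi ⟩
    10 ^ suc r * 10 ^ q  ≡⟨ ^-distribˡ-+-* 10 (suc r) q ⟨
    10 ^ suc (r + q)     ∎
    where open ≤-Reasoning

ceilLog10Aux-spec : ∀ x f k → x ≤ 10 ^ (k + f) → 10 ^ k < 10 * x →
  x ≤ 10 ^ ceilLog10Aux x f k × 10 ^ ceilLog10Aux x f k < 10 * x
ceilLog10Aux-spec x zero    k up lo = subst (λ z → x ≤ 10 ^ z) (+-identityʳ k) up , lo
ceilLog10Aux-spec x (suc f) k up lo with x ≤ᵇ 10 ^ k in eq
... | true  = ≤ᵇ⇒≤ x (10 ^ k) (subst T (sym eq) _) , lo
... | false = ceilLog10Aux-spec x f (suc k) (subst (λ z → x ≤ 10 ^ z) (+-suc k f) up)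
                (*-monoʳ-< 10 (≰⇒> λ x≤ → subst T eq (≤⇒≤ᵇ {x} {10 ^ k} x≤)))

n<10^n : ∀ n → n < 10 ^ n
n<10^n zero    = s≤s z≤n
n<10^n (suc n) = begin-strict
  suc n                  ≤⟨ n<10^n n ⟩
  10 ^ n                 <⟨ m<m+n (10 ^ n) (*-monoʳ-< 9 (m^n>0 10 n)) ⟩
  10 ^ n + 9 * 10 ^ n    ∎
  where open ≤-Reasoning

ceilLog10-spec : ∀ x → 1 ≤ x → x ≤ 10 ^ ceilLog10 x × 10 ^ ceilLog10 x < 10 * x
ceilLog10-spec x 1≤x =
  ceilLog10Aux-spec x (suc x) 0 (<⇒≤ (<-≤-trans (n<10^n x) (^-monoʳ-≤ 10 (n≤1+n x))))
    (≤-trans (s≤s (s≤s z≤n)) (*-monoʳ-≤ 10 1≤x))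

ceilLog10-suc : ∀ y → 1 ≤ y → ceilLog10 (suc y) ≡ ndigits y
ceilLog10-suc y 1≤y with ndigits-spec y 1≤y | ceilLog10-spec (suc y) (s≤s z≤n)
... | r , eq , lo , hi | up , down = trans (≤-antisym c≤ c≥) (sym eq)
  where
  c : ℕ
  c = ceilLog10 (suc y)
  c≥ : suc r ≤ c
  c≥ = 10^-cancel-< (≤-<-trans lo up)
  c≤ : c ≤ suc r
  c≤ = ≤-pred (10^-cancel-< (<-≤-trans down (*-monoʳ-≤ 10 hi)))

floor-/-remainder : ∀ i d .{{_ : NonZero d}} → ∃ λ ρ → ρ < d × i ≡ + ρ +ℤ floor (i /ℚ d) *ℤ + d
floor-/-remainder i d = remainder (i /ℚ d) (ℚP.↥-/ i d) (ℚP.↧-/ i d)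
  where
  remainder : ∀ q {g} → ℚ.↥ q *ℤ + g ≡ i → ℚ.↧ q *ℤ + g ≡ + d →
              ∃ λ ρ → ρ < d × i ≡ + ρ +ℤ floor q *ℤ + d
  remainder q@(ℚ.mkℚ num den-1 _) {g} num*g≡i den*g≡+d = r * g , r*g<d , i≡
    where
    den r : ℕ
    den = suc den-1
    r = num %ℤ + den
    den*g≡d : den * g ≡ d
    den*g≡d = ℤP.+-injective (trans (ℤP.pos-* den g) den*g≡+d)
    instance
      g≢0 : NonZero g
      g≢0 = ≢-nonZero λ { refl → ≢-nonZero⁻¹ d (trans (sym den*g≡d) (*-zeroʳ den)) }
    r*g<d : r * g < d
    r*g<d = subst (r * g <_) den*g≡d (*-monoˡ-< g (n%d<d num (+ den)))
    i≡ : i ≡ + (r * g) +ℤ floor q *ℤ + d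
    i≡ = begin
      i                                          ≡⟨ num*g≡i ⟨
      num *ℤ + g                                 ≡⟨ cong (_*ℤ + g) (a≡a%n+[a/n]*n num (+ den)) ⟩
      (+ r +ℤ floor q *ℤ + den) *ℤ + g           ≡⟨ distrib (+ r) (floor q) (+ den) (+ g) ⟩
      + r *ℤ + g +ℤ floor q *ℤ (+ den *ℤ + g)    ≡⟨ cong₂ (λ a b → a +ℤ floor q *ℤ b) (ℤP.pos-* r g) (sym den*g≡+d) ⟨
      + (r * g) +ℤ floor q *ℤ + d                ∎
      where
      open ≡-Reasoning
      distrib : ∀ a b c e → (a +ℤ b *ℤ c) *ℤ e ≡ a *ℤ e +ℤ b *ℤ (c *ℤ e)
      distrib = ℤ-Solver.solve-∀

U-suc : ∀ U0 d m → U U0 d (suc m) ≡ d + U U0 d m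
U-suc U0 d m = solve U0 d m
  where
  solve : ∀ U0 d m → U0 + suc m * d ≡ d + (U0 + m * d)
  solve = ℕ-Solver.solve-∀

n*d+S[0]+1≡1+U[n] : ∀ U0 d n → n * d + S U0 d 0 + 1 ≡ suc (U U0 d n)
n*d+S[0]+1≡1+U[n] U0 d n = solve U0 d n
  where
  solve : ∀ U0 d n → n * d + (U0 + 0 * d) + 1 ≡ suc (U0 + n * d)
  solve = ℕ-Solver.solve-∀

U-mono-≤ : ∀ U0 d {m m′} → m ≤ m′ → U U0 d m ≤ U U0 d m′
U-mono-≤ U0 d m≤m′ = +-monoʳ-≤ U0 (*-monoˡ-≤ d m≤m′)

U-cancel-≤ : ∀ U0 d .{{_ : NonZero d}} {m m′} → U U0 d m ≤ U U0 d m′ → m ≤ m′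
U-cancel-≤ U0 d {m} {m′} le = *-cancelʳ-≤ m m′ d (+-cancelˡ-≤ U0 (m * d) (m′ * d) le)

U-positive : ∀ U0 d .{{_ : NonZero U0}} m → 1 ≤ U U0 d m
U-positive U0 d m = ≤-trans (>-nonZero⁻¹ U0) (m≤m+n U0 (m * d))

U-floor-bounds : ∀ U0 d .{{_ : NonZero d}} b → + 0 ≤ℤ floor ((+ b -ℤ + U U0 d 0) /ℚ d) →
  let t = ∣ floor ((+ b -ℤ + U U0 d 0) /ℚ d) ∣ in U U0 d t ≤ b × b < U U0 d (suc t)
U-floor-bounds U0 d b 0≤⌊⌋ with floor-/-remainder (+ b -ℤ + U U0 d 0) d
... | ρ , ρ<d , b-U0≡ = subst (U U0 d t ≤_) (sym b≡) (m≤n+m (U U0 d t) ρ)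
                      , subst₂ _<_ (sym b≡) (sym (U-suc U0 d t)) (+-monoˡ-< (U U0 d t) ρ<d)
  where
  t v : ℕ
  t = ∣ floor ((+ b -ℤ + U U0 d 0) /ℚ d) ∣
  v = U U0 d 0
  +b≡ : + b ≡ + (ρ + t * d + v)
  +b≡ = begin
    + b                                          ≡⟨ sub-add (+ b) (+ v) ⟩
    (+ b -ℤ + v) +ℤ + v                          ≡⟨ cong (_+ℤ + v) b-U0≡ ⟩
    + ρ +ℤ floor ((+ b -ℤ + v) /ℚ d) *ℤ + d +ℤ + v ≡⟨ cong (λ z → + ρ +ℤ z *ℤ + d +ℤ + v) ⌊⌋≡+t ⟩
    + ρ +ℤ + t *ℤ + d +ℤ + v                     ≡⟨ cong (λ z → + ρ +ℤ z +ℤ + v) (ℤP.pos-* t d) ⟨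
    + ρ +ℤ + (t * d) +ℤ + v                      ≡⟨ cong (_+ℤ + v) (ℤP.pos-+ ρ (t * d)) ⟨
    + (ρ + t * d) +ℤ + v                         ≡⟨ ℤP.pos-+ (ρ + t * d) v ⟨
    + (ρ + t * d + v)                            ∎
    where
    open ≡-Reasoning
    sub-add : ∀ i j → i ≡ (i -ℤ j) +ℤ j
    sub-add = ℤ-Solver.solve-∀
    ⌊⌋≡+t : floor ((+ b -ℤ + v) /ℚ d) ≡ + t
    ⌊⌋≡+t = sym (ℤP.0≤i⇒+∣i∣≡i 0≤⌊⌋)
  b≡ : b ≡ ρ + U U0 d t
  b≡ = trans (ℤP.+-injective +b≡) (rearrange ρ t d U0)
    where
    rearrange : ∀ ρ t d U0 → ρ + t * d + (U0 + 0 * d) ≡ ρ + (U0 + t * d)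
    rearrange = ℕ-Solver.solve-∀

U[2+t]<10^[1+r] : ∀ U0 d .{{_ : NonZero U0}} .{{_ : NonZero d}} r t → U U0 d t ≤ 10 ^ r →
  (∃ λ m₀ → ∃ λ m₁ → ∃ λ m₂ → ∃ λ m₃ → m₀ < m₁ × m₁ < m₂ × m₂ < m₃ ×
     ndigits (U U0 d m₀) ≡ suc r × ndigits (U U0 d m₁) ≡ suc r ×
     ndigits (U U0 d m₂) ≡ suc r × ndigits (U U0 d m₃) ≡ suc r) →
  U U0 d (2 + t) < 10 ^ suc r
U[2+t]<10^[1+r] U0 d r t Ut≤10^r (m₀ , _ , m₂ , _ , m₀<m₁ , m₁<m₂ , _ , digits₀ , _ , digits₂ , _) =
  ≤-<-trans (U-mono-≤ U0 d 2+t≤m₂) (proj₂ (ndigits-bounds (U-positive U0 d m₂) digits₂))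
  where
  -- Three of the four indices suffice: m₂ ≥ m₀ + 2 ≥ t + 2.
  t≤m₀ : t ≤ m₀
  t≤m₀ = U-cancel-≤ U0 d (≤-trans Ut≤10^r (proj₁ (ndigits-bounds (U-positive U0 d m₀) digits₀)))
  2+t≤m₂ : 2 + t ≤ m₂
  2+t≤m₂ = ≤-trans (s≤s (s≤s t≤m₀)) (≤-trans (s≤s m₀<m₁) m₁<m₂)

-- Σ_{i<j} (u + (i+1)d) L^i; for u = U t and L = 10^l this is the number whose
-- l-digit blocks are U(t+j), …, U(t+1).
blockSum : (u d L : ℕ) → ℕ → ℕ
blockSum u d L zero    = 0
blockSum u d L (suc j) = blockSum u d L j + (u + suc j * d) * L ^ j

S-block : ∀ U0 d r t → 10 ^ r ≤ U U0 d (suc t) → ∀ j → U U0 d (j + t) < 10 ^ suc r →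
  S U0 d (j + t) ≡ S U0 d t + 10 ^ ndigits (S U0 d t) * blockSum (U U0 d t) d (10 ^ suc r) j
  × ndigits (S U0 d (j + t)) ≡ ndigits (S U0 d t) + suc r * j
S-block U0 d r t _ zero _ = sym (trans (cong (λ z → S U0 d t + z) (*-zeroʳ (10 ^ ndigits (S U0 d t)))) (+-identityʳ _))
                           , sym (trans (cong (λ z → ndigits (S U0 d t) + z) (*-zeroʳ (suc r))) (+-identityʳ _))
S-block U0 d r t 10^r≤ (suc j) U<L
  with S-block U0 d r t 10^r≤ j (≤-<-trans (U-mono-≤ U0 d (n≤1+n (j + t))) U<L)
... | value , digits = value′ , digits′
  where
  s₀ p P L F a : ℕ
  s₀ = S U0 d t
  p  = ndigits s₀
  P  = 10 ^ p
  L  = 10 ^ suc r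
  F  = blockSum (U U0 d t) d L j
  a  = U U0 d (suc (j + t))
  10^digits : 10 ^ (p + suc r * j) ≡ P * L ^ j
  10^digits = trans (^-distribˡ-+-* 10 p (suc r * j)) (cong (λ z → P * z) (sym (^-*-assoc 10 (suc r) j)))
  value′ : a * 10 ^ ndigits (S U0 d (j + t)) + S U0 d (j + t) ≡ s₀ + P * blockSum (U U0 d t) d L (suc j)
  value′ = begin
    a * 10 ^ ndigits (S U0 d (j + t)) + S U0 d (j + t) ≡⟨ cong₂ (λ e s → a * 10 ^ e + s) digits value ⟩
    a * 10 ^ (p + suc r * j) + (s₀ + P * F)           ≡⟨ cong (λ z → a * z + (s₀ + P * F)) 10^digits ⟩
    a * (P * L ^ j) + (s₀ + P * F)                    ≡⟨ append U0 t j d P (L ^ j) s₀ F ⟩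
    s₀ + P * (F + (U U0 d t + suc j * d) * L ^ j)     ∎
    where
    open ≡-Reasoning
    append : ∀ U0 t j d P Y s₀ F → (U0 + suc (j + t) * d) * (P * Y) + (s₀ + P * F)
                                   ≡ s₀ + P * (F + ((U0 + t * d) + suc j * d) * Y)
    append = ℕ-Solver.solve-∀
  digits′ : ndigits (a * 10 ^ ndigits (S U0 d (j + t)) + S U0 d (j + t)) ≡ p + suc r * suc j
  digits′ = begin
    ndigits (a * 10 ^ ndigits (S U0 d (j + t)) + S U0 d (j + t))
      ≡⟨ ndigits-concat (S U0 d (j + t)) (≤-trans 10^r≤ (U-mono-≤ U0 d (s≤s (m≤n+m t j)))) U<L ⟩
    suc r + ndigits (S U0 d (j + t))  ≡⟨ cong (λ z → suc r + z) digits ⟩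
    suc r + (p + suc r * j)           ≡⟨ shift r p j ⟩
    p + suc r * suc j                 ∎
    where
    open ≡-Reasoning
    shift : ∀ r p j → suc r + (p + suc r * j) ≡ p + suc r * suc j
    shift = ℕ-Solver.solve-∀

-- (L-1)² Σ_{i<k} (u + (i+1)d) L^i = L^k ((L-1)u + k(L-1)d - d) + d - (L-1)u,
-- with the terms moved so that no subtraction occurs.
blockSum-closed : ∀ u d N k → N * N * blockSum u d (suc N) k + suc N ^ k * d + u * N
                               ≡ suc N ^ k * u * N + k * suc N ^ k * d * N + d
blockSum-closed u d N zero    = base u d N
  where
  base : ∀ u d N → N * N * 0 + 1 * d + u * N ≡ 1 * u * N + 0 * 1 * d * N + d
  base = ℕ-Solver.solve-∀
blockSum-closed u d N (suc k) = +-cancelʳ-≡ (Y * d) _ _ (begin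
    N * N * (F + (u + suc k * d) * Y) + suc N * Y * d + u * N + Y * d ≡⟨ split u d N F Y k ⟩
    (N * N * F + Y * d + u * N) + R                                  ≡⟨ cong (_+ R) (blockSum-closed u d N k) ⟩
    (Y * u * N + k * Y * d * N + d) + R                              ≡⟨ merge u d N Y k ⟩
    suc N * Y * u * N + suc k * (suc N * Y) * d * N + d + Y * d      ∎)
  where
  open ≡-Reasoning
  Y F R : ℕ
  Y = suc N ^ k
  F = blockSum u d (suc N) k
  R = N * N * (u + suc k * d) * Y + suc N * Y * d
  split : ∀ u d N F Y k → N * N * (F + (u + suc k * d) * Y) + suc N * Y * d + u * N + Y * d
                         ≡ (N * N * F + Y * d + u * N) + (N * N * (u + suc k * d) * Y + suc N * Y * d)
  split = ℕ-Solver.solve-∀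
  merge : ∀ u d N Y k → (Y * u * N + k * Y * d * N + d) + (N * N * (u + suc k * d) * Y + suc N * Y * d)
                       ≡ suc N * Y * u * N + suc k * (suc N * Y) * d * N + d + Y * d
  merge = ℕ-Solver.solve-∀

numerator-identityℕ : ∀ N s₀ P u d k X F →
  N * N * F + X * d + u * N ≡ X * u * N + k * X * d * N + d →
  let L  = suc N
      s₁ = s₀ + P * blockSum u d L 1
      s₂ = s₀ + P * blockSum u d L 2
  in s₂ + L * L * s₀ + N * u * P * X + d * P * N * k * X ≡ (s₀ + P * F) * (N * N) + 2 * L * s₁ + d * P * X
numerator-identityℕ N s₀ P u d k X F closed =
  +-cancelʳ-≡ (P * (X * u * N + k * X * d * N + d)) _ _
    (trans (cong (λ z → lhs + P * z) (sym closed)) (identity N s₀ P u d k X F))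
  where
  lhs : ℕ
  lhs = s₀ + P * blockSum u d (suc N) 2 + suc N * suc N * s₀ + N * u * P * X + d * P * N * k * X
  -- blockSum u d (suc N) 1 and 2 unfolded, as the solver does not unfold definitions.
  identity : ∀ N s₀ P u d k X F →
    s₀ + P * (0 + (u + 1 * d) * 1 + (u + 2 * d) * (suc N * 1)) + suc N * suc N * s₀
      + N * u * P * X + d * P * N * k * X + P * (N * N * F + X * d + u * N)
    ≡ (s₀ + P * F) * (N * N) + 2 * suc N * (s₀ + P * (0 + (u + 1 * d) * 1)) + d * P * X
      + P * (X * u * N + k * X * d * N + d)
  identity = ℕ-Solver.solve-∀

ℕ-rearrangement⇒ℤ : ∀ a b c e f p x g n k m →
  a + c + e * p * x + g * n * k * x ≡ m + b + f * p * x →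
  + a -ℤ + b +ℤ + c +ℤ (+ e -ℤ + f) *ℤ + p *ℤ + x +ℤ + g *ℤ + n *ℤ + k *ℤ + x ≡ + m
ℕ-rearrangement⇒ℤ a b c e f p x g n k m eq = begin
  + a -ℤ + b +ℤ + c +ℤ (+ e -ℤ + f) *ℤ + p *ℤ + x +ℤ + g *ℤ + n *ℤ + k *ℤ + x
    ≡⟨ regroup (+ a) (+ b) (+ c) (+ e) (+ f) (+ p) (+ x) (+ g) (+ n) (+ k) ⟩
  (+ a +ℤ + c +ℤ + e *ℤ + p *ℤ + x +ℤ + g *ℤ + n *ℤ + k *ℤ + x) -ℤ (+ b +ℤ + f *ℤ + p *ℤ + x)
    ≡⟨ cong₂ _-ℤ_ (sym lhs-cast) (sym rhs-cast) ⟩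
  + (a + c + e * p * x + g * n * k * x) -ℤ + (b + f * p * x)
    ≡⟨ cong (λ z → + z -ℤ + (b + f * p * x)) (trans eq (+-assoc m b (f * p * x))) ⟩
  + (m + (b + f * p * x)) -ℤ + (b + f * p * x)
    ≡⟨ cong (_-ℤ + (b + f * p * x)) (ℤP.pos-+ m (b + f * p * x)) ⟩
  + m +ℤ + (b + f * p * x) -ℤ + (b + f * p * x)
    ≡⟨ add-sub (+ m) (+ (b + f * p * x)) ⟩
  + m ∎
  where
  open ≡-Reasoning
  regroup : ∀ a b c e f p x g n k →
    a -ℤ b +ℤ c +ℤ (e -ℤ f) *ℤ p *ℤ x +ℤ g *ℤ n *ℤ k *ℤ x
    ≡ (a +ℤ c +ℤ e *ℤ p *ℤ x +ℤ g *ℤ n *ℤ k *ℤ x) -ℤ (b +ℤ f *ℤ p *ℤ x)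
  regroup = ℤ-Solver.solve-∀
  add-sub : ∀ i j → i +ℤ j -ℤ j ≡ i
  add-sub = ℤ-Solver.solve-∀
  pos-*³ : ∀ a b c → + (a * b * c) ≡ + a *ℤ + b *ℤ + c
  pos-*³ a b c = trans (ℤP.pos-* (a * b) c) (cong (_*ℤ + c) (ℤP.pos-* a b))
  lhs-cast : + (a + c + e * p * x + g * n * k * x) ≡ + a +ℤ + c +ℤ + e *ℤ + p *ℤ + x +ℤ + g *ℤ + n *ℤ + k *ℤ + x
  lhs-cast = trans (ℤP.pos-+ (a + c + e * p * x) (g * n * k * x))
    (cong₂ _+ℤ_ (trans (ℤP.pos-+ (a + c) (e * p * x)) (cong₂ _+ℤ_ (ℤP.pos-+ a c) (pos-*³ e p x)))
                (trans (ℤP.pos-* (g * n * k) x) (cong (_*ℤ + x) (pos-*³ g n k))))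
  rhs-cast : + (b + f * p * x) ≡ + b +ℤ + f *ℤ + p *ℤ + x
  rhs-cast = trans (ℤP.pos-+ b (f * p * x)) (cong (+ b +ℤ_) (pos-*³ f p x))

numerator-identity : ∀ {L N X k s₁ s₂ Sn} s₀ P u d → L ≡ suc N → X ≡ L ^ k →
  s₁ ≡ s₀ + P * blockSum u d L 1 → s₂ ≡ s₀ + P * blockSum u d L 2 → Sn ≡ s₀ + P * blockSum u d L k →
  + s₂ -ℤ + (2 * L * s₁) +ℤ + (L * L * s₀) +ℤ (+ (N * u) -ℤ + d) *ℤ + P *ℤ + X +ℤ + (d * P) *ℤ + N *ℤ + k *ℤ + X
    ≡ + Sn *ℤ + (N * N)
numerator-identity {N = N} {k = k} s₀ P u d refl refl refl refl refl =
  trans (ℕ-rearrangement⇒ℤ s₂ (2 * L * s₁) (L * L * s₀) (N * u) d P X (d * P) N k (Sn * (N * N))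
          (numerator-identityℕ N s₀ P u d k X F (blockSum-closed u d N k)))
        (ℤP.pos-* Sn (N * N))
  where
  L X F s₁ s₂ Sn : ℕ
  L  = suc N
  X  = L ^ k
  F  = blockSum u d L k
  s₁ = s₀ + P * blockSum u d L 1
  s₂ = s₀ + P * blockSum u d L 2
  Sn = s₀ + P * F

ℤtoℚ : ℤ → ℚ
ℤtoℚ i = i /ℚ 1

fromℚᵘ-+ : ∀ p q → ℚ.fromℚᵘ (p ℚᵘ.+ q) ≡ ℚ.fromℚᵘ p +ℚ ℚ.fromℚᵘ q
fromℚᵘ-+ p q = ℚP.toℚᵘ-injective (begin
  ℚ.toℚᵘ (ℚ.fromℚᵘ (p ℚᵘ.+ q))                        ≈⟨ ℚP.toℚᵘ-fromℚᵘ (p ℚᵘ.+ q) ⟩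
  p ℚᵘ.+ q                                             ≈⟨ ℚᵘP.+-cong (ℚP.toℚᵘ-fromℚᵘ p) (ℚP.toℚᵘ-fromℚᵘ q) ⟨
  ℚ.toℚᵘ (ℚ.fromℚᵘ p) ℚᵘ.+ ℚ.toℚᵘ (ℚ.fromℚᵘ q)         ≈⟨ ℚP.toℚᵘ-homo-+ (ℚ.fromℚᵘ p) (ℚ.fromℚᵘ q) ⟨
  ℚ.toℚᵘ (ℚ.fromℚᵘ p +ℚ ℚ.fromℚᵘ q)                    ∎)
  where open ℚᵘP.≃-Reasoning

fromℚᵘ-* : ∀ p q → ℚ.fromℚᵘ (p ℚᵘ.* q) ≡ ℚ.fromℚᵘ p *ℚ ℚ.fromℚᵘ q
fromℚᵘ-* p q = ℚP.toℚᵘ-injective (begin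
  ℚ.toℚᵘ (ℚ.fromℚᵘ (p ℚᵘ.* q))                        ≈⟨ ℚP.toℚᵘ-fromℚᵘ (p ℚᵘ.* q) ⟩
  p ℚᵘ.* q                                             ≈⟨ ℚᵘP.*-cong (ℚP.toℚᵘ-fromℚᵘ p) (ℚP.toℚᵘ-fromℚᵘ q) ⟨
  ℚ.toℚᵘ (ℚ.fromℚᵘ p) ℚᵘ.* ℚ.toℚᵘ (ℚ.fromℚᵘ q)         ≈⟨ ℚP.toℚᵘ-homo-* (ℚ.fromℚᵘ p) (ℚ.fromℚᵘ q) ⟨
  ℚ.toℚᵘ (ℚ.fromℚᵘ p *ℚ ℚ.fromℚᵘ q)                    ∎)
  where open ℚᵘP.≃-Reasoning

-- ℤtoℚ i and i /ℕ suc m are by definition fromℚᵘ (mkℚᵘ i 0) and fromℚᵘ (mkℚᵘ i m).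
ℤtoℚ-+ : ∀ i j → ℤtoℚ (i +ℤ j) ≡ ℤtoℚ i +ℚ ℤtoℚ j
ℤtoℚ-+ i j = trans (ℚP.fromℚᵘ-cong {ℚᵘ.mkℚᵘ (i +ℤ j) 0} {ℚᵘ.mkℚᵘ i 0 ℚᵘ.+ ℚᵘ.mkℚᵘ j 0} (ℚᵘ.*≡* (identity i j)))
                   (fromℚᵘ-+ (ℚᵘ.mkℚᵘ i 0) (ℚᵘ.mkℚᵘ j 0))
  where
  identity : ∀ i j → (i +ℤ j) *ℤ + 1 ≡ (i *ℤ + 1 +ℤ j *ℤ + 1) *ℤ + 1
  identity = ℤ-Solver.solve-∀

ℤtoℚ-* : ∀ i j → ℤtoℚ (i *ℤ j) ≡ ℤtoℚ i *ℚ ℤtoℚ j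
ℤtoℚ-* i j = fromℚᵘ-* (ℚᵘ.mkℚᵘ i 0) (ℚᵘ.mkℚᵘ j 0)

ℕtoℚ-* : ∀ m n → ℕtoℚ (m * n) ≡ ℕtoℚ m *ℚ ℕtoℚ n
ℕtoℚ-* m n = trans (cong ℤtoℚ (ℤP.pos-* m n)) (ℤtoℚ-* (+ m) (+ n))

/ℕ-*-cancel : ∀ i n .{{_ : NonZero n}} → (i /ℕ n) *ℚ ℕtoℚ n ≡ ℤtoℚ i
/ℕ-*-cancel i (suc m) = trans (sym (fromℚᵘ-* (ℚᵘ.mkℚᵘ i m) (ℚᵘ.mkℚᵘ (+ suc m) 0)))
                              (ℚP.fromℚᵘ-cong {ℚᵘ.mkℚᵘ i m ℚᵘ.* ℚᵘ.mkℚᵘ (+ suc m) 0} {ℚᵘ.mkℚᵘ i 0} (ℚᵘ.*≡* identity))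
  where
  identity : i *ℤ + suc m *ℤ + 1 ≡ i *ℤ + (suc m * 1)
  identity = trans (ℤP.*-identityʳ _) (cong (λ n → i *ℤ + n) (sym (*-identityʳ (suc m))))

*-cancelʳ-≡ℚ : ∀ p q r .{{_ : ℚ.NonZero r}} → p *ℚ r ≡ q *ℚ r → p ≡ q
*-cancelʳ-≡ℚ p q r eq = trans (sym (undo p)) (trans (cong (_*ℚ ℚ.1/ r) eq) (undo q))
  where
  undo : ∀ x → x *ℚ r *ℚ ℚ.1/ r ≡ x
  undo x = trans (ℚP.*-assoc x r (ℚ.1/ r)) (trans (cong (x *ℚ_) (ℚP.*-inverseʳ r)) (ℚP.*-identityʳ x))

/ℕ-combine : ∀ A M T N x k s .{{_ : NonZero N}} →
  A +ℤ M *ℤ + x +ℤ T *ℤ + N *ℤ + k *ℤ + x ≡ + s *ℤ + (N * N) →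
  ℕtoℚ s ≡ A /ℕ (N * N) +ℚ M /ℕ (N * N) *ℚ ℕtoℚ x +ℚ T /ℕ N *ℚ ℕtoℚ k *ℚ ℕtoℚ x
/ℕ-combine A M T N x k s eq = *-cancelʳ-≡ℚ _ _ (ℕtoℚ (N * N)) (begin
  ℕtoℚ s *ℚ ℕtoℚ (N * N)                              ≡⟨ ℤtoℚ-* (+ s) (+ (N * N)) ⟨
  ℤtoℚ (+ s *ℤ + (N * N))                             ≡⟨ cong ℤtoℚ eq ⟨
  ℤtoℚ (A +ℤ M *ℤ + x +ℤ T *ℤ + N *ℤ + k *ℤ + x)      ≡⟨ homomorphism ⟩
  ℤtoℚ A +ℚ ℤtoℚ M *ℚ qx +ℚ ℤtoℚ T *ℚ c *ℚ qk *ℚ qx   ≡⟨ cong₂ (λ a b → a +ℚ b *ℚ qx +ℚ ℤtoℚ T *ℚ c *ℚ qk *ℚ qx)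
                                                           (/ℕ-*-cancel A (N * N)) (/ℕ-*-cancel M (N * N)) ⟨
  α *ℚ c² +ℚ μ *ℚ c² *ℚ qx +ℚ ℤtoℚ T *ℚ c *ℚ qk *ℚ qx ≡⟨ cong (λ t → α *ℚ c² +ℚ μ *ℚ c² *ℚ qx +ℚ t *ℚ c *ℚ qk *ℚ qx)
                                                           (/ℕ-*-cancel T N) ⟨
  α *ℚ c² +ℚ μ *ℚ c² *ℚ qx +ℚ θ *ℚ c *ℚ c *ℚ qk *ℚ qx  ≡⟨ cong (λ z → α *ℚ z +ℚ μ *ℚ z *ℚ qx +ℚ θ *ℚ c *ℚ c *ℚ qk *ℚ qx) c²≡ ⟩
  α *ℚ (c *ℚ c) +ℚ μ *ℚ (c *ℚ c) *ℚ qx +ℚ θ *ℚ c *ℚ c *ℚ qk *ℚ qx ≡⟨ factor α μ θ c qx qk ⟩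
  (α +ℚ μ *ℚ qx +ℚ θ *ℚ qk *ℚ qx) *ℚ (c *ℚ c)         ≡⟨ cong (λ z → (α +ℚ μ *ℚ qx +ℚ θ *ℚ qk *ℚ qx) *ℚ z) c²≡ ⟨
  (α +ℚ μ *ℚ qx +ℚ θ *ℚ qk *ℚ qx) *ℚ ℕtoℚ (N * N)     ∎)
  where
  open ≡-Reasoning
  instance
    N²≢0 : NonZero (N * N)
    N²≢0 = m*n≢0 N N
    c²≢0 : ℚ.NonZero (ℕtoℚ (N * N))
    c²≢0 = ℚP.pos⇒nonZero (ℕtoℚ (N * N)) {{ℚP.normalize-pos (N * N) 1}}
  α μ θ c c² qx qk : ℚ
  α = A /ℕ (N * N)
  μ = M /ℕ (N * N)
  θ = T /ℕ N
  c = ℕtoℚ N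
  c² = ℕtoℚ (N * N)
  qx = ℕtoℚ x
  qk = ℕtoℚ k
  c²≡ : c² ≡ c *ℚ c
  c²≡ = ℕtoℚ-* N N
  homomorphism : ℤtoℚ (A +ℤ M *ℤ + x +ℤ T *ℤ + N *ℤ + k *ℤ + x) ≡ ℤtoℚ A +ℚ ℤtoℚ M *ℚ qx +ℚ ℤtoℚ T *ℚ c *ℚ qk *ℚ qx
  homomorphism = begin
    ℤtoℚ (A +ℤ M *ℤ + x +ℤ T *ℤ + N *ℤ + k *ℤ + x)        ≡⟨ ℤtoℚ-+ (A +ℤ M *ℤ + x) (T *ℤ + N *ℤ + k *ℤ + x) ⟩
    ℤtoℚ (A +ℤ M *ℤ + x) +ℚ ℤtoℚ (T *ℤ + N *ℤ + k *ℤ + x)  ≡⟨ cong₂ _+ℚ_ (trans (ℤtoℚ-+ A (M *ℤ + x)) (cong (ℤtoℚ A +ℚ_) (ℤtoℚ-* M (+ x))))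
                                                                      (trans (ℤtoℚ-* (T *ℤ + N *ℤ + k) (+ x))
                                                                        (cong (_*ℚ qx) (trans (ℤtoℚ-* (T *ℤ + N) (+ k))
                                                                          (cong (_*ℚ qk) (ℤtoℚ-* T (+ N)))))) ⟩
    ℤtoℚ A +ℚ ℤtoℚ M *ℚ qx +ℚ ℤtoℚ T *ℚ c *ℚ qk *ℚ qx    ∎
  factor : ∀ α μ θ c x k → α *ℚ (c *ℚ c) +ℚ μ *ℚ (c *ℚ c) *ℚ x +ℚ θ *ℚ c *ℚ c *ℚ k *ℚ x
                          ≡ (α +ℚ μ *ℚ x +ℚ θ *ℚ k *ℚ x) *ℚ (c *ℚ c)
  factor = solve 6 (λ α μ θ c x k → α :* (c :* c) :+ μ :* (c :* c) :* x :+ θ :* c :* c :* k :* x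
                                    := (α :+ μ :* x :+ θ :* k :* x) :* (c :* c)) refl
    where open ℚ-Solver

α μ θ : (U0 d l t : ℕ) → ℚ
α U0 d l t = (+ S U0 d (2 + t) -ℤ + (2 * 10 ^ l * S U0 d (1 + t)) +ℤ + (10 ^ l * 10 ^ l * S U0 d t))
             /ℕ ((10 ^ l ∸ 1) * (10 ^ l ∸ 1))
μ U0 d l t = ((+ ((10 ^ l ∸ 1) * U U0 d t) -ℤ + d) *ℤ + (10 ^ ndigits (S U0 d t))) /ℕ ((10 ^ l ∸ 1) * (10 ^ l ∸ 1))
θ U0 d l t = (+ (d * 10 ^ ndigits (S U0 d t))) /ℕ (10 ^ l ∸ 1)

S-closedForm : ∀ U0 d n r t → 10 ^ r ≤ U U0 d (suc t) → U U0 d (2 + t) < 10 ^ suc r →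
  t ≤ n → U U0 d n < 10 ^ suc r →
  let l = suc r
      k = n ∸ t
  in ℕtoℚ (S U0 d n) ≡ α U0 d l t +ℚ μ U0 d l t *ℚ ℕtoℚ (10 ^ (l * k)) +ℚ θ U0 d l t *ℚ ℕtoℚ k *ℚ ℕtoℚ (10 ^ (l * k))
S-closedForm U0 d n r t 10^r≤U[1+t] U[2+t]<L t≤n U[n]<L =
  /ℕ-combine _ _ _ N X k (S U0 d n)
    (numerator-identity s₀ P u d L≡ X≡ (value 1 U[1+t]<L) (value 2 U[2+t]<L) Sn≡)
  where
  L N k X s₀ P u : ℕ
  L  = 10 ^ suc r
  N  = L ∸ 1
  k  = n ∸ t
  X  = 10 ^ (suc r * k)
  s₀ = S U0 d t
  P  = 10 ^ ndigits s₀
  u  = U U0 d t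
  1<L : 1 < L
  1<L = ^-monoʳ-< 10 (s≤s (s≤s z≤n)) {0} {suc r} (s≤s z≤n)
  instance
    N≢0 : NonZero N
    N≢0 = >-nonZero (m<n⇒0<n∸m 1<L)
  L≡ : L ≡ suc N
  L≡ = sym (m+[n∸m]≡n (<⇒≤ 1<L))
  X≡ : X ≡ L ^ k
  X≡ = sym (^-*-assoc 10 (suc r) k)
  U[1+t]<L : U U0 d (1 + t) < L
  U[1+t]<L = ≤-<-trans (U-mono-≤ U0 d (n≤1+n (suc t))) U[2+t]<L
  value : ∀ j → U U0 d (j + t) < L → S U0 d (j + t) ≡ s₀ + P * blockSum u d L j
  value j U<L = proj₁ (S-block U0 d r t 10^r≤U[1+t] j U<L)
  k+t≡n : k + t ≡ n
  k+t≡n = m∸n+n≡m t≤n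
  Sn≡ : S U0 d n ≡ s₀ + P * blockSum u d L k
  Sn≡ = subst (λ m → S U0 d m ≡ s₀ + P * blockSum u d L k) k+t≡n
              (value k (subst (λ m → U U0 d m < L) (sym k+t≡n) U[n]<L))

theorem2 : (U0 d : ℕ) → .{{_ : NonZero U0}} → .{{_ : NonZero d}} → (n : ℕ) →
  let l  = ceilLog10 (n * d + S U0 d 0 + 1)
      tl = floor ((+ (10 ^ (l ∸ 1)) -ℤ + (S U0 d 0)) /ℚ d)
  in + 0 ≤ℤ tl →
  (∃ λ m₀ → ∃ λ m₁ → ∃ λ m₂ → ∃ λ m₃ → m₀ < m₁ × m₁ < m₂ × m₂ < m₃ ×
     ndigits (U U0 d m₀) ≡ l × ndigits (U U0 d m₁) ≡ l ×
     ndigits (U U0 d m₂) ≡ l × ndigits (U U0 d m₃) ≡ l) →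
  let t  = ∣ tl ∣
      pl = ndigits (S U0 d t)
      s₀ = S U0 d t
      s₁ = S U0 d (1 + t)
      s₂ = S U0 d (2 + t)
      L  = 10 ^ l
      αl = (+ s₂ -ℤ + (2 * L * s₁) +ℤ + (L * L * s₀)) /ℕ ((L ∸ 1) * (L ∸ 1))
      μl = ((+ ((L ∸ 1) * U U0 d t) -ℤ + d) *ℤ + (10 ^ pl)) /ℕ ((L ∸ 1) * (L ∸ 1))
      θl = (+ (d * 10 ^ pl)) /ℕ (L ∸ 1)
      k  = n ∸ t
  in ℕtoℚ (S U0 d n) ≡ αl +ℚ μl *ℚ ℕtoℚ (10 ^ (l * k)) +ℚ θl *ℚ ℕtoℚ k *ℚ ℕtoℚ (10 ^ (l * k))
theorem2 U0 d n 0≤⌊⌋ four with n * d + S U0 d 0 + 1 | n*d+S[0]+1≡1+U[n] U0 d n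
... | _ | refl with ceilLog10 (suc (U U0 d n)) | ceilLog10-suc (U U0 d n) (U-positive U0 d n)
... | _ | refl with ndigits (U U0 d n) | ndigits-spec (U U0 d n) (U-positive U0 d n)
... | _ | r , refl , 10^r≤Un , Un<L =
  S-closedForm U0 d n r t (<⇒≤ 10^r<U[1+t]) (U[2+t]<10^[1+r] U0 d r t Ut≤10^r four)
    (U-cancel-≤ U0 d (≤-trans Ut≤10^r 10^r≤Un)) Un<L
  where
  t : ℕ
  t = ∣ floor ((+ (10 ^ r) -ℤ + S U0 d 0) /ℚ d) ∣
  Ut≤10^r : U U0 d t ≤ 10 ^ r
  Ut≤10^r = proj₁ (U-floor-bounds U0 d (10 ^ r) 0≤⌊⌋)
  10^r<U[1+t] : 10 ^ r < U U0 d (suc t)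
  10^r<U[1+t] = proj₂ (U-floor-bounds U0 d (10 ^ r) 0≤⌊⌋)
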